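{- Let $n\geq 2$ and let $F$ be a directed 2-factor of $\vec{C}_n \wr \vec{C}_3$. Then there exists an integer $k$ with $0 \leq k \leq 3$ such that $|A(F)\cap A(C^i_3)|=k$ for all $i \in \mathbb{Z}_n$.
   Context: Let $V(\vec{C}_n)=\mathbb{Z}_n$ with arcs $(i,i+1)$ and $V(\vec{C}_3)=\mathbb{Z}_3$ with arcs $(j,j+1)$. The wreath product $\vec{C}_n\wr\vec{C}_3$ has vertex set $\mathbb{Z}_n\times\mathbb{Z}_3$, with $((g_1,h_1),(g_2,h_2))$ an arc iff $(g_1,g_2)$ is an arc of $\vec{C}_n$, or $g_1=g_2$ and $(h_1,h_2)$ is an arc of $\vec{C}_3$. Write $i_j$ for the vertex $(i,j)$. For $i\in\mathbb{Z}_n$, $C^i_3$ denotes the directed 3-cycle $i_0\, i_1\, i_2\, i_0$ (its arcs are the horizontal arcs at $i$). A directed 2-factor of a digraph is a spanning subdigraph that is a vertex-disjoint union of directed cycles. -}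

module Defs where

open import Data.Nat using (ℕ; zero; suc)
open import Data.Nat.DivMod using (_%_; m%n<n)
open import Data.Fin using (Fin; toℕ; fromℕ<; _≟_)
open import Data.Product using (_×_; _,_; proj₁; proj₂)
open import Data.Product.Properties using (≡-dec)
open import Data.List using (length; filter)
open import Function.Definitions using (Injective; Surjective)
open import Relation.Binary.PropositionalEquality using (_≡_)
import Data.List as L

sucMod : {n : ℕ} → Fin n → Fin n
sucMod {suc m} i = fromℕ< (m%n<n (suc (toℕ i)) (suc m))

ArcC : {n : ℕ} → Fin n → Fin n → Set
ArcC g₁ g₂ = g₂ ≡ sucMod g₁

-- vertices of C_n ≀ C_3 :  Z_n × Z_3 ;  (i , j) is the vertex i_j
V : ℕ → Set
V n = Fin n × Fin 3

data ArcW {n : ℕ} : V n → V n → Set where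
  vert  : ∀ {g₁ g₂ h₁ h₂} → ArcC g₁ g₂ → ArcW (g₁ , h₁) (g₂ , h₂)
  horiz : ∀ {g h₁ h₂} → ArcC h₁ h₂ → ArcW (g , h₁) (g , h₂)

-- A directed 2-factor: spanning subdigraph in which every vertex has
-- in-degree and out-degree exactly 1; encoded by the successor map
-- succ (v → succ v is the unique out-arc of v in F), which is a
-- bijection of V and sends each vertex along an arc of the digraph.
record TwoFactor (n : ℕ) : Set where
  field
    succ      : V n → V n
    isArc     : ∀ v → ArcW v (succ v)
    injective : Injective _≡_ _≡_ succ
    surjective : Surjective _≡_ _≡_ succ

_∈A_ : {n : ℕ} → V n × V n → TwoFactor n → Set
(u , v) ∈A F = TwoFactor.succ F u ≡ v

-- |A(F) ∩ A(C^i_3)| : number of j ∈ Z_3 with (i_j , i_{j+1}) ∈ A(F)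
horizCount : {n : ℕ} → TwoFactor n → Fin n → ℕ
horizCount {n} F i =
  length (filter (λ j → ≡-dec _≟_ _≟_ (TwoFactor.succ F (i , j)) (i , sucMod j))
                 (L.allFin 3))

-- Call layer i the vertices i_0, i_1, i_2, and let h(i) be the number of
-- horizontal arcs of F inside layer i.  An arc of F leaving layer i is either
-- horizontal or goes to layer i + 1, and an arc entering layer i + 1 is either
-- horizontal or comes from layer i; for n ≥ 2 these alternatives exclude each
-- other.  Since every vertex has exactly one out-arc and one in-arc in F, the
-- 3 − h(i) non-horizontal arcs out of layer i are exactly the 3 − h(i + 1)
-- non-horizontal arcs into layer i + 1, so h(i + 1) = h(i) and h is constant.

module Submission where

open import Defs
open import Level using (Level)
open import Data.Nat using (ℕ; zero; suc; _+_; _≤_; s≤s)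
open import Data.Nat.Properties using (≤-antisym; +-suc; +-cancelʳ-≡; 1+n≢n)
open import Data.Nat.DivMod using (_%_; m<n⇒m%n≡m; n%n≡0)
open import Data.Fin using (Fin; zero; suc; toℕ; inject₁; fromℕ; _≟_)
open import Data.Fin.Properties using (toℕ-injective; toℕ-fromℕ<; toℕ-fromℕ; toℕ-inject₁; toℕ<n; injective⇒≤)
open import Data.Fin.Induction using (<-weakInduction)
open import Data.List using (List; []; _∷_; length; filter; lookup; allFin)
open import Data.List.Properties using (length-filter; length-tabulate; filter-≐)
open import Data.List.Membership.Propositional.Properties using (∈-filter⁺; ∈-filter⁻; ∈-allFin; ∈-lookup)
import Data.List.Relation.Unary.All as All
open import Data.List.Relation.Unary.AllPairs using (_∷_)
open import Data.List.Relation.Unary.Any using (index)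
open import Data.List.Relation.Unary.Any.Properties using (lookup-index)
open import Data.List.Relation.Unary.Unique.Propositional using (Unique)
open import Data.List.Relation.Unary.Unique.Propositional.Properties using (allFin⁺; filter⁺)
open import Data.Product using (∃; _×_; _,_; proj₁; proj₂)
open import Data.Product.Properties using (≡-dec)
open import Data.Sum as Sum using (_⊎_; inj₁; inj₂; [_,_]′)
open import Data.Empty using (⊥-elim)
open import Function using (id; _∘′_)
open import Function.Definitions using (Injective)
open import Relation.Nullary using (¬_; yes; no; contradiction)
open import Relation.Unary using (Pred; Decidable)
open import Relation.Binary.PropositionalEquality
  using (_≡_; _≢_; refl; sym; trans; cong; cong₂; subst; module ≡-Reasoning)

open ≡-Reasoning

private
  variable
    a p q : Level
    A : Set a
    k l m n : ℕ

lookup-injective : {xs : List A} → Unique xs → Injective _≡_ _≡_ (lookup xs)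
lookup-injective (_ ∷ _) {zero} {zero} _ = refl
lookup-injective (x∉xs ∷ _) {zero} {suc j} eq = contradiction eq (All.lookup x∉xs (∈-lookup j))
lookup-injective (x∉xs ∷ _) {suc i} {zero} eq = contradiction (sym eq) (All.lookup x∉xs (∈-lookup i))
lookup-injective (_ ∷ xs!) {suc i} {suc j} eq = cong suc (lookup-injective xs! eq)

module _ {P : Pred A p} {Q : Pred A q} (P? : Decidable P) (Q? : Decidable Q)
         (cover : ∀ x → P x ⊎ Q x) (disjoint : ∀ {x} → P x → ¬ Q x) where

  length-filter-partition : ∀ xs → length (filter P? xs) + length (filter Q? xs) ≡ length xs
  length-filter-partition [] = refl
  length-filter-partition (x ∷ xs) with ih ← length-filter-partition xs | P? x | Q? x
  ... | yes px  | yes qx  = contradiction qx (disjoint px)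
  ... | yes _   | no _    = cong suc ih
  ... | no _    | yes _   = trans (+-suc _ _) (cong suc ih)
  ... | no ¬px  | no ¬qx  = ⊥-elim ([ ¬px , ¬qx ]′ (cover x))

count : {P : Pred (Fin k) p} → Decidable P → ℕ
count {k = k} P? = length (filter P? (allFin k))

module _ {P : Pred (Fin k) p} (P? : Decidable P) where

  element : Fin (count P?) → Fin k
  element = lookup (filter P? (allFin k))

  position : ∀ {j} → P j → Fin (count P?)
  position {j} pj = index (∈-filter⁺ P? (∈-allFin j) pj)

  element-position : ∀ {j} (pj : P j) → element (position pj) ≡ j
  element-position {j} pj = sym (lookup-index (∈-filter⁺ P? (∈-allFin j) pj))

  element-satisfies : ∀ x → P (element x)
  element-satisfies x = proj₂ (∈-filter⁻ P? {xs = allFin k} (∈-lookup x))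

  element-injective : Injective _≡_ _≡_ element
  element-injective = lookup-injective (filter⁺ P? (allFin⁺ k))

module _ {P : Pred (Fin k) p} {Q : Pred (Fin l) q} (P? : Decidable P) (Q? : Decidable Q) where

  retract⇒count-≤ : (f : Fin k → Fin l) (g : Fin l → Fin k) →
                    (∀ {j} → P j → Q (f j)) → (∀ {j} → P j → g (f j) ≡ j) →
                    count P? ≤ count Q?
  retract⇒count-≤ f g f-into g-retracts = injective⇒≤ φ-injective
    where
    φ : Fin (count P?) → Fin (count Q?)
    φ x = position Q? (f-into (element-satisfies P? x))

    f∘element≡element∘φ : ∀ x → f (element P? x) ≡ element Q? (φ x)
    f∘element≡element∘φ x = sym (element-position Q? _)

    φ-injective : Injective _≡_ _≡_ φ
    φ-injective {x} {y} φx≡φy = element-injective P? (begin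
      element P? x            ≡⟨ sym (g-retracts (element-satisfies P? x)) ⟩
      g (f (element P? x))    ≡⟨ cong g (f∘element≡element∘φ x) ⟩
      g (element Q? (φ x))    ≡⟨ cong (g ∘′ element Q?) φx≡φy ⟩
      g (element Q? (φ y))    ≡⟨ cong g (sym (f∘element≡element∘φ y)) ⟩
      g (f (element P? y))    ≡⟨ g-retracts (element-satisfies P? y) ⟩
      element P? y            ∎)

module _ {P : Pred (Fin k) p} {Q : Pred (Fin l) q} (P? : Decidable P) (Q? : Decidable Q) where

  inverse⇒count-≡ : (f : Fin k → Fin l) (g : Fin l → Fin k) →
                    (∀ {j} → P j → Q (f j)) → (∀ {s} → Q s → P (g s)) →
                    (∀ {j} → P j → g (f j) ≡ j) → (∀ {s} → Q s → f (g s) ≡ s) →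
                    count P? ≡ count Q?
  inverse⇒count-≡ f g f-into g-into g∘f≡id f∘g≡id =
    ≤-antisym (retract⇒count-≤ P? Q? f g f-into g∘f≡id) (retract⇒count-≤ Q? P? g f g-into f∘g≡id)

module _ {P : Pred (Fin k) p} {Q : Pred (Fin k) q} (P? : Decidable P) (Q? : Decidable Q) where

  count-partition : (∀ j → P j ⊎ Q j) → (∀ {j} → P j → ¬ Q j) → count P? + count Q? ≡ k
  count-partition cover disjoint =
    trans (length-filter-partition P? Q? cover disjoint (allFin k)) (length-tabulate id)

inject₁-or-fromℕ : (i : Fin (suc m)) → (∃ λ j → i ≡ inject₁ j) ⊎ i ≡ fromℕ m
inject₁-or-fromℕ {zero}  zero    = inj₂ refl
inject₁-or-fromℕ {suc _} zero    = inj₁ (zero , refl)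
inject₁-or-fromℕ {suc _} (suc i) =
  Sum.map (λ (j , i≡j) → suc j , cong suc i≡j) (cong suc) (inject₁-or-fromℕ i)

module _ {m : ℕ} where

  sucMod-inject₁ : (j : Fin m) → sucMod (inject₁ j) ≡ suc j
  sucMod-inject₁ j = toℕ-injective (begin
    toℕ (sucMod (inject₁ j))        ≡⟨ toℕ-fromℕ< _ ⟩
    suc (toℕ (inject₁ j)) % suc m   ≡⟨ cong (λ t → suc t % suc m) (toℕ-inject₁ j) ⟩
    suc (toℕ j) % suc m             ≡⟨ m<n⇒m%n≡m (s≤s (toℕ<n j)) ⟩
    suc (toℕ j)                     ∎)

  sucMod-fromℕ : sucMod (fromℕ m) ≡ zero
  sucMod-fromℕ = toℕ-injective (begin
    toℕ (sucMod (fromℕ m))        ≡⟨ toℕ-fromℕ< _ ⟩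
    suc (toℕ (fromℕ m)) % suc m   ≡⟨ cong (λ t → suc t % suc m) (toℕ-fromℕ m) ⟩
    suc m % suc m                 ≡⟨ n%n≡0 (suc m) ⟩
    0                             ∎)

  predMod : Fin (suc m) → Fin (suc m)
  predMod zero    = fromℕ m
  predMod (suc j) = inject₁ j

  predMod-sucMod : (i : Fin (suc m)) → predMod (sucMod i) ≡ i
  predMod-sucMod i with inject₁-or-fromℕ i
  ... | inj₁ (j , refl) = cong predMod (sucMod-inject₁ j)
  ... | inj₂ refl       = cong predMod sucMod-fromℕ

  sucMod-injective : Injective _≡_ _≡_ (sucMod {suc m})
  sucMod-injective {i} {j} eq = begin
    i                  ≡⟨ sym (predMod-sucMod i) ⟩
    predMod (sucMod i) ≡⟨ cong predMod eq ⟩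
    predMod (sucMod j) ≡⟨ predMod-sucMod j ⟩
    j                  ∎

  sucMod-induction : (P : Pred (Fin (suc m)) p) → P zero → (∀ i → P i → P (sucMod i)) → ∀ i → P i
  sucMod-induction P P₀ step =
    <-weakInduction P P₀ (λ j Pj → subst P (sucMod-inject₁ j) (step (inject₁ j) Pj))

sucMod-≢ : (i : Fin (suc (suc m))) → sucMod i ≢ i
sucMod-≢ i eq with inject₁-or-fromℕ i
... | inj₁ (j , refl) = 1+n≢n (begin
  suc (toℕ j)              ≡⟨ cong toℕ (sym (sucMod-inject₁ j)) ⟩
  toℕ (sucMod (inject₁ j)) ≡⟨ cong toℕ eq ⟩
  toℕ (inject₁ j)          ≡⟨ toℕ-inject₁ j ⟩
  toℕ j                    ∎)
... | inj₂ refl with () ← trans (sym sucMod-fromℕ) eq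

arc-vertical-or-horizontal : {u w : V n} → ArcW u w →
                             proj₁ w ≡ sucMod (proj₁ u) ⊎ w ≡ (proj₁ u , sucMod (proj₂ u))
arc-vertical-or-horizontal (vert g₁→g₂)  = inj₁ g₁→g₂
arc-vertical-or-horizontal (horiz h₁→h₂) = inj₂ (cong (_ ,_) h₁→h₂)

module LayerCounts (F : TwoFactor n) where
  open TwoFactor F

  pre : V n → V n
  pre v = proj₁ (surjective v)

  succ-pre : ∀ v → succ (pre v) ≡ v
  succ-pre v = proj₂ (surjective v) refl

  pre-succ : ∀ v → pre (succ v) ≡ v
  pre-succ v = injective (succ-pre (succ v))

  pre-arc : ∀ v → ArcW (pre v) v
  pre-arc v = subst (ArcW (pre v)) (succ-pre v) (isArc (pre v))

  leadsTo? : (a b : Fin n) → Decidable (λ j → proj₁ (succ (a , j)) ≡ b)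
  leadsTo? a b j = proj₁ (succ (a , j)) ≟ b

  comesFrom? : (a b : Fin n) → Decidable (λ s → proj₁ (pre (b , s)) ≡ a)
  comesFrom? a b s = proj₁ (pre (b , s)) ≟ a

  outCount : Fin n → Fin n → ℕ
  outCount a b = count (leadsTo? a b)

  inCount : Fin n → Fin n → ℕ
  inCount a b = count (comesFrom? a b)

  outCount≡inCount : ∀ a b → outCount a b ≡ inCount a b
  outCount≡inCount a b = inverse⇒count-≡ (leadsTo? a b) (comesFrom? a b) head tail
    (cong proj₁ ∘′ pre-head) (cong proj₁ ∘′ succ-tail)
    (cong proj₂ ∘′ pre-head) (cong proj₂ ∘′ succ-tail)
    where
    head : Fin 3 → Fin 3
    head j = proj₂ (succ (a , j))

    tail : Fin 3 → Fin 3
    tail s = proj₂ (pre (b , s))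

    pre-head : ∀ {j} → proj₁ (succ (a , j)) ≡ b → pre (b , head j) ≡ (a , j)
    pre-head {j} a→b = trans (cong (λ c → pre (c , head j)) (sym a→b)) (pre-succ (a , j))

    succ-tail : ∀ {s} → proj₁ (pre (b , s)) ≡ a → succ (a , tail s) ≡ (b , s)
    succ-tail {s} a→b = trans (cong (λ c → succ (c , tail s)) (sym a→b)) (succ-pre (b , s))

module _ (F : TwoFactor (suc (suc m))) where
  open TwoFactor F
  open LayerCounts F

  horizontal? : (i : Fin (suc (suc m))) → Decidable (λ j → succ (i , j) ≡ (i , sucMod j))
  horizontal? i j = ≡-dec _≟_ _≟_ (succ (i , j)) (i , sucMod j)

  stays⇒horizontal : ∀ {i j} → proj₁ (succ (i , j)) ≡ i → succ (i , j) ≡ (i , sucMod j)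
  stays⇒horizontal {i} {j} stays with arc-vertical-or-horizontal (isArc (i , j))
  ... | inj₁ vertical   = contradiction (trans (sym vertical) stays) (sucMod-≢ i)
  ... | inj₂ horizontal = horizontal

  horizCount≡outCount : ∀ i → horizCount F i ≡ outCount i i
  horizCount≡outCount i =
    cong length (filter-≐ (horizontal? i) (leadsTo? i i) (cong proj₁ , stays⇒horizontal) (allFin 3))

  outCount-partition : ∀ i → outCount i i + outCount i (sucMod i) ≡ 3
  outCount-partition i = count-partition (leadsTo? i i) (leadsTo? i (sucMod i)) cover disjoint
    where
    cover : ∀ j → proj₁ (succ (i , j)) ≡ i ⊎ proj₁ (succ (i , j)) ≡ sucMod i
    cover j = Sum.swap (Sum.map₂ (cong proj₁) (arc-vertical-or-horizontal (isArc (i , j))))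

    disjoint : ∀ {j} → proj₁ (succ (i , j)) ≡ i → proj₁ (succ (i , j)) ≢ sucMod i
    disjoint stays leaves = sucMod-≢ i (trans (sym leaves) stays)

  inCount-partition : ∀ i → inCount (sucMod i) (sucMod i) + inCount i (sucMod i) ≡ 3
  inCount-partition i =
    count-partition (comesFrom? (sucMod i) (sucMod i)) (comesFrom? i (sucMod i)) cover disjoint
    where
    cover : ∀ s → proj₁ (pre (sucMod i , s)) ≡ sucMod i ⊎ proj₁ (pre (sucMod i , s)) ≡ i
    cover s = Sum.swap (Sum.map (λ vertical → sucMod-injective (sym vertical))
                                (λ horizontal → sym (cong proj₁ horizontal))
                                (arc-vertical-or-horizontal (pre-arc (sucMod i , s))))

    disjoint : ∀ {s} → proj₁ (pre (sucMod i , s)) ≡ sucMod i → proj₁ (pre (sucMod i , s)) ≢ i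
    disjoint stays enters = sucMod-≢ i (trans (sym stays) enters)

  horizCount-sucMod : ∀ i → horizCount F (sucMod i) ≡ horizCount F i
  horizCount-sucMod i = +-cancelʳ-≡ (outCount i i′) _ _ (begin
    horizCount F i′ + outCount i i′  ≡⟨ cong₂ _+_ (horizCount≡outCount i′) (outCount≡inCount i i′) ⟩
    outCount i′ i′ + inCount i i′    ≡⟨ cong (_+ inCount i i′) (outCount≡inCount i′ i′) ⟩
    inCount i′ i′ + inCount i i′     ≡⟨ inCount-partition i ⟩
    3                                ≡⟨ sym (outCount-partition i) ⟩
    outCount i i + outCount i i′     ≡⟨ cong (_+ outCount i i′) (sym (horizCount≡outCount i)) ⟩
    horizCount F i + outCount i i′   ∎)
    where i′ = sucMod i

lemma6p2 : (n : ℕ) → 2 ≤ n → (F : TwoFactor n) →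
    ∃ λ (k : ℕ) → k ≤ 3 × ((i : Fin n) → horizCount F i ≡ k)
lemma6p2 _ (s≤s (s≤s _)) F =
  horizCount F zero , length-filter (horizontal? F zero) (allFin 3) ,
  sucMod-induction (λ i → horizCount F i ≡ horizCount F zero) refl
    (λ i hᵢ≡h₀ → trans (horizCount-sucMod F i) hᵢ≡h₀)
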